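{- Let $m$ be a positive integer and $n = 2^m - 1$. Let $A = (a_{i,j})$ be the $n \times n$ matrix over $\mathbb{Z}/2\mathbb{Z}$ given by $a_{i,j} = 1$ if $|i-j| = 1$ and $a_{i,j} = 0$ otherwise. Then $A^n$ is the zero matrix. -}

module Defs where

open import Data.Bool using (Bool; true; false; _xor_; _∧_)
open import Data.Nat using (ℕ; zero; suc; _≡ᵇ_)
open import Data.Fin using (Fin; toℕ)
open import Data.Vec.Functional using (foldr)

-- Z/2Z modelled as Bool: addition = xor, multiplication = ∧, 0 = false, 1 = true.
Z2 : Set
Z2 = Bool

Mat : ℕ → Set
Mat n = Fin n → Fin n → Z2

sumZ2 : ∀ {n} → (Fin n → Z2) → Z2
sumZ2 = foldr _xor_ false

_⊗_ : ∀ {n} → Mat n → Mat n → Mat n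
(M ⊗ N) i j = sumZ2 (λ k → M i k ∧ N k j)

identity : ∀ {n} → Mat n
identity i j = toℕ i ≡ᵇ toℕ j

_^ᴹ_ : ∀ {n} → Mat n → ℕ → Mat n
M ^ᴹ zero = identity
M ^ᴹ suc k = M ⊗ (M ^ᴹ k)

zeroMat : ∀ {n} → Mat n
zeroMat _ _ = false

absDiffIsOne : ℕ → ℕ → Bool
absDiffIsOne zero zero = false
absDiffIsOne zero (suc zero) = true
absDiffIsOne zero (suc (suc _)) = false
absDiffIsOne (suc zero) zero = true
absDiffIsOne (suc (suc _)) zero = false
absDiffIsOne (suc i) (suc j) = absDiffIsOne i j

tridiag : ∀ {n} → Mat n
tridiag i j = absDiffIsOne (toℕ i) (toℕ j)

module Submission where

-- The proof is the "method of images" for the path graph, in characteristic two.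
--
-- A vector v of length n is encoded as a sequence w : ℤ → Z/2 which vanishes at
-- 0 and P = n + 1, is symmetric about both of these points (the odd reflection
-- of v, since -1 = 1), and reads v on the window 1..n.  On such sequences the
-- tridiagonal matrix A acts as the operator T w x = w (x + 1) + w (x - 1); the
-- symmetries replace the boundary conditions of the path.
--
-- With Δ d w x = w (x + d) + w (x - d) one has Δ d ∘ Δ d = Δ (2d) in
-- characteristic two, so T^(2^k) = Δ (2^k) (a Frobenius identity).  If w is
-- odd about 0 and 2p then Δ p w is odd about 0 and p, so T^p halves the window;
-- a sequence odd about 0 and 1 is zero.  Induction on m gives
-- T^(2^m - 1) w = 0 for every w odd about 0 and 2^m, and since column j of A^k
-- is encoded by T^k applied to the encoding of the j-th unit vector, A^n = 0.

open import Defs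
open import Algebra.Bundles using (CommutativeRing)
open import Data.Bool using (false; _xor_; _∧_)
open import Data.Bool.Properties
  using (xor-comm; xor-assoc; xor-same; xor-identityʳ; ∧-distribʳ-xor; xor-∧-commutativeRing)
open import Algebra.Properties.CommutativeMonoid.Sum
  (CommutativeRing.+-commutativeMonoid xor-∧-commutativeRing)
  using (∑-distrib-+; sum-cong-≗; sum-replicate-zero)
open import Data.Fin using (Fin; toℕ; fromℕ<) renaming (zero to fzero; suc to fsuc)
open import Data.Fin.Properties using (toℕ<n; toℕ-fromℕ<)
open import Data.Integer using (ℤ; +_; -[1+_]; -_; _+_; _-_; _⊖_; 0ℤ; 1ℤ; ∣_∣)
import Data.Integer.Properties as ℤₚ
open import Data.Integer.Tactic.RingSolver using (solve-∀)
open import Data.Nat as ℕ using (ℕ; zero; suc; _^_; _∸_; _≥_; _≤_; _<_; _⊓_; _%_; _≡ᵇ_; z≤n; s≤s)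
import Data.Nat.Properties as ℕₚ
open import Data.Nat.DivMod using ([m+n]%n≡m%n; m<n⇒m%n≡m; n%n≡0)
open import Data.Sum using (inj₁; inj₂)
open import Function using (const; _∘_)
open import Relation.Nullary using (yes; no)
open import Relation.Binary.PropositionalEquality

open ≡-Reasoning

xor-cancel-middle : ∀ a b c → (a xor b) xor (b xor c) ≡ a xor c
xor-cancel-middle a b c = begin
  (a xor b) xor (b xor c)  ≡⟨ xor-assoc a b (b xor c) ⟩
  a xor (b xor (b xor c))  ≡⟨ cong (a xor_) (xor-assoc b b c) ⟨
  a xor ((b xor b) xor c)  ≡⟨ cong (λ e → a xor (e xor c)) (xor-same b) ⟩
  a xor c                  ∎

private
  shift-out-in : ∀ a b d → (a + d) + (b - d) ≡ a + b
  shift-out-in = solve-∀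
  shift-in-out : ∀ a b d → (a - d) + (b + d) ≡ a + b
  shift-in-out = solve-∀
  shift-out-out : ∀ a b d → (a + d) + (b + d) ≡ (a + b) + (d + d)
  shift-out-out = solve-∀
  shift-in-in : ∀ a b d → (a - d) + (b - d) ≡ (a + b) - (d + d)
  shift-in-in = solve-∀
  double-outer : ∀ c d → ((c + d) + (c + d)) + (d + d) ≡ (c + d + d) + (c + d + d)
  double-outer = solve-∀
  double-inner : ∀ c d → ((c + d) + (c + d)) - (d + d) ≡ c + c
  double-inner = solve-∀
  add-sub : ∀ x d → (x + d) - d ≡ x
  add-sub = solve-∀
  sub-add : ∀ x d → (x - d) + d ≡ x
  sub-add = solve-∀
  sub-sub : ∀ x d → (x - d) - d ≡ x - (d + d)
  sub-sub = solve-∀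
  sub-then-add : ∀ a b e → (a - e) + b ≡ (a + b) - e
  sub-then-add = solve-∀
  sum-to-neg : ∀ a b → a ≡ - b + (a + b)
  sum-to-neg = solve-∀
  two-step-mirror : ∀ x → (x + + 2) + - x ≡ 1ℤ + 1ℤ
  two-step-mirror = solve-∀

Seq : Set
Seq = ℤ → Z2

Δ : ℤ → Seq → Seq
Δ d w x = w (x + d) xor w (x - d)

T : Seq → Seq
T = Δ 1ℤ

iterT : ℕ → Seq → Seq
iterT zero    w = w
iterT (suc k) w = T (iterT k w)

SymmetricAbout : ℤ → Seq → Set
SymmetricAbout c w = ∀ a b → a + b ≡ c + c → w a ≡ w b

-- Odd reflection about c in characteristic two: symmetric, and zero at c.
record OddAbout (c : ℤ) (w : Seq) : Set where
  field
    symmetric : SymmetricAbout c w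
    vanishes  : w c ≡ false
open OddAbout

OddAbout-resp : ∀ {c w w′} → w ≗ w′ → OddAbout c w → OddAbout c w′
OddAbout-resp w≗w′ o = record
  { symmetric = λ a b h → trans (sym (w≗w′ a)) (trans (symmetric o a b h) (w≗w′ b))
  ; vanishes  = trans (sym (w≗w′ _)) (vanishes o)
  }

Δ-cong : ∀ {d w w′} → w ≗ w′ → Δ d w ≗ Δ d w′
Δ-cong w≗w′ x = cong₂ _xor_ (w≗w′ _) (w≗w′ _)

Δ-odd : ∀ {c d w} → OddAbout c w → OddAbout c (Δ d w)
Δ-odd {c} {d} {w} o = record { symmetric = sym-Δ ; vanishes = zero-Δ }
  where
  sym-Δ : SymmetricAbout c (Δ d w)
  sym-Δ a b h = trans
    (cong₂ _xor_ (symmetric o (a + d) (b - d) (trans (shift-out-in a b d) h))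
                 (symmetric o (a - d) (b + d) (trans (shift-in-out a b d) h)))
    (xor-comm (w (b - d)) (w (b + d)))
  zero-Δ : Δ d w c ≡ false
  zero-Δ = trans (cong (_xor w (c - d)) (symmetric o (c + d) (c - d) (shift-out-in c c d)))
                 (xor-same (w (c - d)))

Δ-odd-between : ∀ {c d w} → OddAbout c w → OddAbout (c + d + d) w → OddAbout (c + d) (Δ d w)
Δ-odd-between {c} {d} {w} o o′ = record { symmetric = sym-Δ ; vanishes = zero-Δ }
  where
  sym-Δ : SymmetricAbout (c + d) (Δ d w)
  sym-Δ a b h = cong₂ _xor_
    (symmetric o′ (a + d) (b + d)
      (trans (shift-out-out a b d) (trans (cong (_+ (d + d)) h) (double-outer c d))))
    (symmetric o (a - d) (b - d)
      (trans (shift-in-in a b d) (trans (cong (_- (d + d)) h) (double-inner c d))))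
  zero-Δ : Δ d w (c + d) ≡ false
  zero-Δ = cong₂ _xor_ (vanishes o′) (trans (cong w (add-sub c d)) (vanishes o))

Δ-double : ∀ d w → Δ d (Δ d w) ≗ Δ (d + d) w
Δ-double d w x = begin
  (w ((x + d) + d) xor w ((x + d) - d)) xor (w ((x - d) + d) xor w ((x - d) - d))
    ≡⟨ cong₂ _xor_ (cong₂ _xor_ (cong w (ℤₚ.+-assoc x d d)) (cong w (add-sub x d)))
                   (cong₂ _xor_ (cong w (sub-add x d)) (cong w (sub-sub x d))) ⟩
  (w (x + (d + d)) xor w x) xor (w x xor w (x - (d + d)))
    ≡⟨ xor-cancel-middle (w (x + (d + d))) (w x) (w (x - (d + d))) ⟩
  Δ (d + d) w x ∎

iterT-+ : ∀ a b w → iterT (a ℕ.+ b) w ≗ iterT a (iterT b w)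
iterT-+ zero    b w x = refl
iterT-+ (suc a) b w   = Δ-cong (iterT-+ a b w)

iterT-odd : ∀ {c w} k → OddAbout c w → OddAbout c (iterT k w)
iterT-odd zero    o = o
iterT-odd (suc k) o = Δ-odd (iterT-odd k o)

2^suc : ∀ k → 2 ^ suc k ≡ 2 ^ k ℕ.+ 2 ^ k
2^suc k = cong (2 ^ k ℕ.+_) (ℕₚ.+-identityʳ (2 ^ k))

frobenius : ∀ k w → iterT (2 ^ k) w ≗ Δ (+ 2 ^ k) w
frobenius zero    w x = refl
frobenius (suc k) w x = begin
  iterT (2 ^ suc k) w x      ≡⟨ cong (λ e → iterT e w x) (2^suc k) ⟩
  iterT (p ℕ.+ p) w x        ≡⟨ iterT-+ p p w x ⟩
  iterT p (iterT p w) x      ≡⟨ frobenius k (iterT p w) x ⟩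
  Δ (+ p) (iterT p w) x      ≡⟨ Δ-cong (frobenius k w) x ⟩
  Δ (+ p) (Δ (+ p) w) x      ≡⟨ Δ-double (+ p) w x ⟩
  Δ (+ (p ℕ.+ p)) w x        ≡⟨ cong (λ e → Δ (+ e) w x) (2^suc k) ⟨
  Δ (+ 2 ^ suc k) w x        ∎
  where
  p : ℕ
  p = 2 ^ k

-- A sequence odd about 0 and about 1 is 2-periodic and zero at 0 and 1, hence zero.
collapse : ∀ {w} → OddAbout 0ℤ w → OddAbout 1ℤ w → w ≗ const false
collapse {w} o₀ o₁ = on-ℤ
  where
  period-2 : ∀ x → w (x + + 2) ≡ w x
  period-2 x = trans (symmetric o₁ (x + + 2) (- x) (two-step-mirror x))
                     (symmetric o₀ (- x) x (ℤₚ.+-inverseˡ x))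
  on-ℕ : ∀ k → w (+ k) ≡ false
  on-ℕ zero          = vanishes o₀
  on-ℕ (suc zero)    = vanishes o₁
  on-ℕ (suc (suc k)) = trans (cong (w ∘ +_) (ℕₚ.+-comm 2 k)) (trans (period-2 (+ k)) (on-ℕ k))
  on-ℤ : ∀ x → w x ≡ false
  on-ℤ (+ k)      = on-ℕ k
  on-ℤ -[1+ k ]   = trans (symmetric o₀ -[1+ k ] (+ suc k) (ℤₚ.+-inverseˡ (+ suc k)))
                          (on-ℕ (suc k))

-- Halving the window 2^m times: T^(2^m - 1) kills every sequence odd about 0 and 2^m.
annihilate : ∀ m {w} → OddAbout 0ℤ w → OddAbout (+ 2 ^ m) w → iterT (2 ^ m ∸ 1) w ≗ const false
annihilate zero    o₀ o₁ = collapse o₀ o₁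
annihilate (suc m) {w} o₀ o₂ₚ x = begin
  iterT (2 ^ suc m ∸ 1) w x      ≡⟨ cong (λ e → iterT e w x) exponent ⟩
  iterT ((p ∸ 1) ℕ.+ p) w x      ≡⟨ iterT-+ (p ∸ 1) p w x ⟩
  iterT (p ∸ 1) (iterT p w) x    ≡⟨ annihilate m half₀ halfₚ x ⟩
  false                          ∎
  where
  p : ℕ
  p = 2 ^ m
  exponent : 2 ^ suc m ∸ 1 ≡ (p ∸ 1) ℕ.+ p
  exponent = trans (cong (_∸ 1) (2^suc m)) (ℕₚ.+-∸-comm p (ℕₚ.m^n>0 2 m))
  half₀ : OddAbout 0ℤ (iterT p w)
  half₀ = OddAbout-resp (sym ∘ frobenius m w) (Δ-odd o₀)
  halfₚ : OddAbout (+ p) (iterT p w)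
  halfₚ = OddAbout-resp (sym ∘ frobenius m w)
            (Δ-odd-between o₀ (subst (λ e → OddAbout (+ e) w) (2^suc m) o₂ₚ))

symmetric-shift : ∀ {c d w} → SymmetricAbout c w → (∀ x → w (x + (d + d)) ≡ w x) →
                  SymmetricAbout (c + d) w
symmetric-shift {c} {d} {w} s period a b h = begin
  w a                    ≡⟨ cong w (sub-add a (d + d)) ⟨
  w (a - (d + d) + (d + d)) ≡⟨ period (a - (d + d)) ⟩
  w (a - (d + d))        ≡⟨ s (a - (d + d)) b mirror ⟩
  w b                    ∎
  where
  mirror : (a - (d + d)) + b ≡ c + c
  mirror = begin
    (a - (d + d)) + b          ≡⟨ sub-then-add a b (d + d) ⟩
    (a + b) - (d + d)          ≡⟨ cong (_- (d + d)) h ⟩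
    ((c + d) + (c + d)) - (d + d) ≡⟨ double-inner c d ⟩
    c + c                      ∎

abs-symmetric : ∀ (f : ℕ → Z2) → SymmetricAbout 0ℤ (f ∘ ∣_∣)
abs-symmetric f a b h = cong f (trans (cong ∣_∣ a≡-b) (ℤₚ.∣-i∣≡∣i∣ b))
  where
  a≡-b : a ≡ - b
  a≡-b = trans (sum-to-neg a b) (trans (cong (λ e → - b + e) h) (ℤₚ.+-identityʳ (- b)))

-- pad v b is the b-th entry of v counted from 1, and zero outside 1..n.
pad : ∀ {n} → (Fin n → Z2) → ℕ → Z2
pad         v zero          = false
pad {zero}  v (suc b)       = false
pad {suc n} v (suc zero)    = v fzero
pad {suc n} v (suc (suc b)) = pad (v ∘ fsuc) (suc b)

pad-entry : ∀ {n} (v : Fin n → Z2) (r : Fin n) → pad v (suc (toℕ r)) ≡ v r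
pad-entry v fzero    = refl
pad-entry v (fsuc r) = pad-entry (v ∘ fsuc) r

pad-end : ∀ {n} (v : Fin n → Z2) → pad v (suc n) ≡ false
pad-end {zero}  v = refl
pad-end {suc n} v = pad-end (v ∘ fsuc)

sum-select : ∀ {n} (v : Fin n → Z2) a → sumZ2 (λ s → (suc (toℕ s) ≡ᵇ a) ∧ v s) ≡ pad v a
sum-select {n}     v zero          = sum-replicate-zero n
sum-select {zero}  v (suc a)       = refl
sum-select {suc n} v (suc zero)    =
  trans (cong (v fzero xor_) (sum-select (v ∘ fsuc) zero)) (xor-identityʳ (v fzero))
sum-select {suc n} v (suc (suc a)) = sum-select (v ∘ fsuc) (suc a)

absDiffIsOne-split : ∀ a c → absDiffIsOne a c ≡ (c ≡ᵇ suc a) xor (suc c ≡ᵇ a)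
absDiffIsOne-split zero           zero           = refl
absDiffIsOne-split zero           (suc zero)     = refl
absDiffIsOne-split zero           (suc (suc c))  = refl
absDiffIsOne-split (suc zero)     zero           = refl
absDiffIsOne-split (suc (suc a))  zero           = refl
absDiffIsOne-split (suc zero)     (suc c)        = absDiffIsOne-split zero c
absDiffIsOne-split (suc (suc a))  (suc c)        = absDiffIsOne-split (suc a) c

-- Matrix-vector product over Z/2Z; column j of M ⊗ N is M ·ᵥ (column j of N).
_·ᵥ_ : ∀ {n} → Mat n → (Fin n → Z2) → Fin n → Z2
(M ·ᵥ v) i = sumZ2 (λ k → M i k ∧ v k)

column : ∀ {n} → Mat n → Fin n → Fin n → Z2
column M j i = M i j

tridiag-row : ∀ {n} (v : Fin n → Z2) (r : Fin n) →
              (tridiag ·ᵥ v) r ≡ pad v (suc (suc (toℕ r))) xor pad v (toℕ r)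
tridiag-row v r = begin
  sumZ2 (λ s → tridiag r s ∧ v s)
    ≡⟨ sum-cong-≗ (λ s → trans (cong (_∧ v s) (absDiffIsOne-split (toℕ r) (toℕ s)))
                               (∧-distribʳ-xor (v s) (up s) (down s))) ⟩
  sumZ2 (λ s → (up s ∧ v s) xor (down s ∧ v s))
    ≡⟨ ∑-distrib-+ (λ s → up s ∧ v s) (λ s → down s ∧ v s) ⟩
  sumZ2 (λ s → up s ∧ v s) xor sumZ2 (λ s → down s ∧ v s)
    ≡⟨ cong₂ _xor_ (sum-select v (suc (suc (toℕ r)))) (sum-select v (toℕ r)) ⟩
  pad v (suc (suc (toℕ r))) xor pad v (toℕ r) ∎
  where
  up down : Fin _ → Z2
  up   s = toℕ s ≡ᵇ suc (toℕ r)
  down s = suc (toℕ s) ≡ᵇ toℕ r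

Encodes : ∀ {n} → Seq → (Fin n → Z2) → Set
Encodes {n} w v = ∀ b → b ≤ suc n → w (+ b) ≡ pad v b

T-encodes : ∀ {n w} {v : Fin n → Z2} → OddAbout 0ℤ w → OddAbout (+ suc n) w →
            Encodes w v → Encodes (T w) (tridiag ·ᵥ v)
T-encodes o₀ oₚ enc zero _ = vanishes (Δ-odd {d = 1ℤ} o₀)
T-encodes {n} {w} {v} o₀ oₚ enc (suc b) (s≤s b≤n) with ℕₚ.m≤n⇒m<n∨m≡n b≤n
... | inj₂ refl = trans (vanishes (Δ-odd {d = 1ℤ} oₚ)) (sym (pad-end (tridiag ·ᵥ v)))
... | inj₁ b<n  = begin
  w (+ suc b + 1ℤ) xor w (+ b)
    ≡⟨ cong (λ e → w (+ e) xor w (+ b)) (ℕₚ.+-comm (suc b) 1) ⟩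
  w (+ suc (suc b)) xor w (+ b)
    ≡⟨ cong₂ _xor_ (enc (suc (suc b)) (s≤s b<n)) (enc b (ℕₚ.m≤n⇒m≤1+n (ℕₚ.<⇒≤ b<n))) ⟩
  pad v (suc (suc b)) xor pad v b
    ≡⟨ cong (λ e → pad v (suc (suc e)) xor pad v e) (toℕ-fromℕ< b<n) ⟨
  pad v (suc (suc (toℕ r))) xor pad v (toℕ r)
    ≡⟨ tridiag-row v r ⟨
  (tridiag ·ᵥ v) r
    ≡⟨ pad-entry (tridiag ·ᵥ v) r ⟨
  pad (tridiag ·ᵥ v) (suc (toℕ r))
    ≡⟨ cong (λ e → pad (tridiag ·ᵥ v) (suc e)) (toℕ-fromℕ< b<n) ⟩
  pad (tridiag ·ᵥ v) (suc b) ∎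
  where
  r : Fin n
  r = fromℕ< b<n

encodes-powers : ∀ {n w} (j : Fin n) → OddAbout 0ℤ w → OddAbout (+ suc n) w →
                 Encodes w (column identity j) →
                 ∀ k → Encodes (iterT k w) (column (tridiag ^ᴹ k) j)
encodes-powers j o₀ oₚ enc zero    = enc
encodes-powers j o₀ oₚ enc (suc k) =
  T-encodes (iterT-odd k o₀) (iterT-odd k oₚ) (encodes-powers j o₀ oₚ enc k)

-- The odd reflection ext of a vector v of length n: with P = n + 1 and Q = 2P,
-- ext x = pad v (fold |x|), where fold is the Q-periodic tent map folding ℕ onto 0..P.
-- It encodes v and is odd about 0 and P.
module Extension {n : ℕ} (v : Fin n → Z2) where

  P Q : ℕ
  P = suc n
  Q = P ℕ.+ P

  tent : ℕ → ℕ
  tent r = r ⊓ (Q ∸ r)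

  fold : ℕ → ℕ
  fold k = tent (k % Q)

  ext : Seq
  ext x = pad v (fold ∣ x ∣)

  tent-reflect : ∀ r → r ≤ Q → tent (Q ∸ r) ≡ tent r
  tent-reflect r r≤Q = begin
    (Q ∸ r) ⊓ (Q ∸ (Q ∸ r)) ≡⟨ cong ((Q ∸ r) ⊓_) (ℕₚ.m∸[m∸n]≡n r≤Q) ⟩
    (Q ∸ r) ⊓ r             ≡⟨ ℕₚ.⊓-comm (Q ∸ r) r ⟩
    r ⊓ (Q ∸ r)             ∎

  fold-periodic : ∀ k → fold (k ℕ.+ Q) ≡ fold k
  fold-periodic k = cong tent ([m+n]%n≡m%n k Q)

  fold-top : fold Q ≡ fold 0
  fold-top = cong tent (n%n≡0 Q)

  -- Reflection r ↦ Q - r, where the ends r = 0 and r = Q are identified by periodicity.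
  fold-reflect : ∀ r → r ≤ Q → fold (Q ∸ r) ≡ fold r
  fold-reflect zero    _   = fold-top
  fold-reflect (suc r) r≤Q with ℕₚ.m≤n⇒m<n∨m≡n r≤Q
  ... | inj₂ r≡Q = trans (cong fold (trans (cong (Q ∸_) r≡Q) (ℕₚ.n∸n≡0 Q)))
                         (trans (sym fold-top) (cong fold (sym r≡Q)))
  ... | inj₁ r<Q = begin
    tent ((Q ∸ suc r) % Q) ≡⟨ cong tent (m<n⇒m%n≡m (ℕₚ.∸-monoʳ-< {Q} {suc r} {0} (s≤s z≤n) r≤Q)) ⟩
    tent (Q ∸ suc r)       ≡⟨ tent-reflect (suc r) r≤Q ⟩
    tent (suc r)           ≡⟨ cong tent (m<n⇒m%n≡m r<Q) ⟨
    tent (suc r % Q)       ∎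

  fold-window : ∀ b → b ≤ P → fold b ≡ b
  fold-window b b≤P = trans (cong tent (m<n⇒m%n≡m b<Q)) (ℕₚ.m≤n⇒m⊓n≡m b≤Q∸b)
    where
    b<Q : b < Q
    b<Q = ℕₚ.≤-<-trans b≤P (ℕₚ.m<m+n P (s≤s z≤n))
    b≤Q∸b : b ≤ Q ∸ b
    b≤Q∸b = ℕₚ.≤-trans b≤P (subst (_≤ Q ∸ b) (ℕₚ.m+n∸m≡n P P) (ℕₚ.∸-monoʳ-≤ Q b≤P))

  ext-encodes : Encodes ext v
  ext-encodes b b≤P = cong (pad v) (fold-window b b≤P)

  ext-periodic : ∀ x → ext (x + + Q) ≡ ext x
  ext-periodic (+ k) = cong (pad v) (fold-periodic k)
  ext-periodic -[1+ k ] with suc k ℕ.≤? Q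
  ... | yes k<Q = trans (cong ext (ℤₚ.⊖-≥ k<Q)) (cong (pad v) (fold-reflect (suc k) k<Q))
  ... | no  k≮Q = begin
    ext (Q ⊖ suc k)           ≡⟨ cong ext (ℤₚ.⊖-< Q<k) ⟩
    ext (- + (suc k ∸ Q))     ≡⟨ cong (pad v ∘ fold) (ℤₚ.∣-i∣≡∣i∣ (+ (suc k ∸ Q))) ⟩
    pad v (fold (suc k ∸ Q))  ≡⟨ cong (pad v) (fold-periodic (suc k ∸ Q)) ⟨
    pad v (fold (suc k ∸ Q ℕ.+ Q)) ≡⟨ cong (pad v ∘ fold) (ℕₚ.m∸n+n≡m (ℕₚ.<⇒≤ Q<k)) ⟩
    ext -[1+ k ]              ∎
    where
    Q<k : Q < suc k
    Q<k = ℕₚ.≰⇒> k≮Q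

  -- ext depends only on |x|, and fold 0 = 0 lies outside 1..n.
  ext-odd₀ : OddAbout 0ℤ ext
  ext-odd₀ = record { symmetric = abs-symmetric (pad v ∘ fold) ; vanishes = refl }

  -- Evenness and period 2P give symmetry about P.
  ext-oddₚ : OddAbout (+ P) ext
  ext-oddₚ = record
    { symmetric = symmetric-shift {0ℤ} {+ P} (symmetric ext-odd₀) ext-periodic
    ; vanishes  = trans (ext-encodes P ℕₚ.≤-refl) (pad-end v)
    }

-- Column j of A^n is encoded by T^n applied to the reflection of the j-th unit
-- vector, which T^n = T^(2^m - 1) annihilates.
mainTheorem2 : (m : ℕ) → m ≥ 1 → let n = 2 ^ m ∸ 1 in
    (i j : Fin n) → (tridiag {n} ^ᴹ n) i j ≡ zeroMat {n} i j
mainTheorem2 m _ i j = begin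
  (tridiag ^ᴹ n) i j                           ≡⟨ pad-entry (column (tridiag ^ᴹ n) j) i ⟨
  pad (column (tridiag ^ᴹ n) j) (suc (toℕ i))  ≡⟨ powers n (suc (toℕ i)) (ℕₚ.m≤n⇒m≤1+n (toℕ<n i)) ⟨
  iterT n ext (+ suc (toℕ i))                  ≡⟨ annihilate m ext-odd₀ ext-odd-2^m _ ⟩
  false                                        ∎
  where
  n : ℕ
  n = 2 ^ m ∸ 1
  open Extension (column identity j)
  powers : ∀ k → Encodes (iterT k ext) (column (tridiag ^ᴹ k) j)
  powers = encodes-powers j ext-odd₀ ext-oddₚ ext-encodes
  ext-odd-2^m : OddAbout (+ 2 ^ m) ext
  ext-odd-2^m = subst (λ e → OddAbout (+ e) ext) (ℕₚ.m+[n∸m]≡n (ℕₚ.m^n>0 2 m)) ext-oddₚ
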